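{- Let $G$ be a graph whose $\operatorname{IR}$-graph $H=G(\operatorname{IR})$ is connected, and let $X$ be an $\operatorname{IR}(G)$-set such that either (i) $G[X]$ has exactly one edge, or (ii) $X$ is independent but at least two vertices of $X$ have $X$-external private neighbours. Then $X$ lies on an induced $4$-cycle of $H$.
   Context: All graphs are finite and simple. For $D\subseteq V(G)$, $v\in D$: $\operatorname{PN}(v,D)=N[v]-N[D-\{v\}]$, $\operatorname{EPN}(v,D)=\operatorname{PN}(v,D)-D$ (the $D$-external private neighbours of $v$). $D$ is irredundant if $\operatorname{PN}(v,D)\ne\varnothing$ for all $v\in D$; $\operatorname{IR}(G)$ is the max size of an irredundant set; an $\operatorname{IR}(G)$-set is an irredundant set of that size. $G(\operatorname{IR})$ has the $\operatorname{IR}(G)$-sets as vertices, $D\sim D'$ iff $D'=(D-\{u\})\cup\{v\}$ for some $u\in D$, $v\in D'$ with $uv\in E(G)$. -}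

module Defs where

open import Data.Nat using (ℕ; _≤_)
open import Data.Bool using (Bool; true; false)
open import Data.Fin using (Fin)
open import Data.Fin.Subset using (Subset; _∈_; _∉_; _∪_; _-_; ⁅_⁆; ∣_∣)
open import Data.Product using (Σ; ∃; ∃-syntax; _×_; _,_)
open import Data.Sum using (_⊎_)
open import Relation.Nullary using (¬_)
open import Relation.Binary.PropositionalEquality using (_≡_; _≢_)
open import Relation.Binary.Construct.Closure.ReflexiveTransitive using (Star)

record Graph (n : ℕ) : Set where
  field
    E     : Fin n → Fin n → Bool
    sym   : ∀ u v → E u v ≡ E v u
    irrefl : ∀ v → E v v ≡ false

module _ {n : ℕ} (G : Graph n) where
  open Graph G

  Adj : Fin n → Fin n → Set
  Adj u v = E u v ≡ true

  InClosedNbhd : Fin n → Fin n → Set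
  InClosedNbhd w v = w ≡ v ⊎ Adj v w

  InPN : Fin n → Fin n → Subset n → Set
  InPN w v D = InClosedNbhd w v × (∀ u → u ∈ D → u ≢ v → ¬ InClosedNbhd w u)

  InEPN : Fin n → Fin n → Subset n → Set
  InEPN w v D = InPN w v D × w ∉ D

  Irredundant : Subset n → Set
  Irredundant D = ∀ v → v ∈ D → ∃[ w ] InPN w v D

  IRSet : Subset n → Set
  IRSet D = Irredundant D × (∀ D' → Irredundant D' → ∣ D' ∣ ≤ ∣ D ∣)

  IRAdj : Subset n → Subset n → Set
  IRAdj D D' = IRSet D × IRSet D' ×
    (∃[ u ] ∃[ v ] (u ∈ D × v ∈ D' × Adj u v × D' ≡ (D - u) ∪ ⁅ v ⁆))

  IRGraphConnected : Set
  IRGraphConnected = ∀ D D' → IRSet D → IRSet D' → Star IRAdj D D'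

  ExactlyOneEdge : Subset n → Set
  ExactlyOneEdge X = ∃[ a ] ∃[ b ] (a ∈ X × b ∈ X × Adj a b ×
    (∀ c d → c ∈ X → d ∈ X → Adj c d →
       (c ≡ a × d ≡ b) ⊎ (c ≡ b × d ≡ a)))

  Independent : Subset n → Set
  Independent X = ∀ a b → a ∈ X → b ∈ X → ¬ Adj a b

  TwoWithEPN : Subset n → Set
  TwoWithEPN X = ∃[ a ] ∃[ b ] (a ≢ b × a ∈ X × b ∈ X ×
    (∃[ w ] InEPN w a X) × (∃[ w ] InEPN w b X))

  OnInduced4Cycle : Subset n → Set
  OnInduced4Cycle X = ∃[ D₁ ] ∃[ D₂ ] ∃[ D₃ ]
    (IRAdj X D₁ × IRAdj D₁ D₂ × IRAdj D₂ D₃ × IRAdj D₃ X ×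
     X ≢ D₂ × D₁ ≢ D₃ × ¬ IRAdj X D₂ × ¬ IRAdj D₁ D₃)

module Submission where

-- Idea: in both cases of the corollary, X has two distinct vertices
-- u₁, u₂ with X-external private neighbours v₁, v₂ such that X - u₁ and
-- X - u₂ are independent (the only possible edge of G[X] is u₁u₂).  Any
-- IR(G)-set D with such a "square configuration" lies on the induced
-- 4-cycle  D ~ D - u₁ + v₁ ~ D - u₁ - u₂ + v₁ + v₂ ~ D - u₂ + v₂ ~ D  of
-- G(IR): the two single exchanges are independent sets, the double
-- exchange is irredundant since v₁, v₂ keep u₁, u₂ as private neighbours,
-- all have the size of D, and opposite corners differ in two vertices.

open import Defs
open import Data.Nat using (ℕ; suc)
open import Data.Nat.Properties using (≤-trans; ≤-reflexive)
open import Data.Fin using (Fin; zero; suc; _≟_)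
open import Data.Fin.Subset
  using (Subset; _∈_; _∉_; _⊆_; _∪_; _-_; _─_; ⁅_⁆; ∣_∣; inside; outside)
open import Data.Fin.Subset.Properties
  using (p─⊥≡p; ∪-identityʳ; ⊆-antisym; x∈p∪q⁻; x∈p∪q⁺; x∈p∧x≢y⇒x∈p-y;
         p─q⊆p; x∈⁅x⁆; x∈⁅y⁆⇒x≡y)
open import Data.Vec.Base using (_∷_; here; there)
open import Data.Product using (_×_; _,_; proj₁; proj₂)
open import Data.Sum using (_⊎_; inj₁; inj₂; [_,_])
import Data.Sum as Sum
open import Function using (_∘_)
open import Data.Empty using (⊥-elim)
open import Relation.Nullary using (¬_; yes; no)
open import Relation.Binary.PropositionalEquality
  using (_≡_; _≢_; refl; sym; trans; cong; subst; module ≡-Reasoning)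

∈─⇒∉ : ∀ {n} {x : Fin n} (p q : Subset n) → x ∈ p ─ q → x ∉ q
∈─⇒∉ (_ ∷ p) (outside ∷ q) here ()
∈─⇒∉ (_ ∷ p) (_ ∷ q) (there x∈) (there x∈q) = ∈─⇒∉ p q x∈ x∈q

module _ {n : ℕ} where

  x∈p-y⇒x≢y : ∀ {x y : Fin n} (p : Subset n) → x ∈ p - y → x ≢ y
  x∈p-y⇒x≢y {x} p x∈ refl = ∈─⇒∉ p ⁅ x ⁆ x∈ (x∈⁅x⁆ x)

  x∈p-y⇒x∈p : ∀ {x y : Fin n} (p : Subset n) → x ∈ p - y → x ∈ p
  x∈p-y⇒x∈p {y = y} p = p─q⊆p p ⁅ y ⁆

∣p-x∣ : ∀ {n} (p : Subset n) (x : Fin n) → x ∈ p → suc ∣ p - x ∣ ≡ ∣ p ∣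
∣p-x∣ (inside ∷ p) zero here = cong suc (cong ∣_∣ (p─⊥≡p p))
∣p-x∣ (inside ∷ p) (suc x) (there x∈p) = cong suc (∣p-x∣ p x x∈p)
∣p-x∣ (outside ∷ p) (suc x) (there x∈p) = ∣p-x∣ p x x∈p

∣p∪⁅y⁆∣ : ∀ {n} (p : Subset n) (y : Fin n) → y ∉ p → ∣ p ∪ ⁅ y ⁆ ∣ ≡ suc ∣ p ∣
∣p∪⁅y⁆∣ (outside ∷ p) zero _ = cong suc (cong ∣_∣ (∪-identityʳ p))
∣p∪⁅y⁆∣ (inside ∷ p) zero y∉ = ⊥-elim (y∉ here)
∣p∪⁅y⁆∣ (inside ∷ p) (suc y) y∉ = cong suc (∣p∪⁅y⁆∣ p y (λ y∈ → y∉ (there y∈)))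
∣p∪⁅y⁆∣ (outside ∷ p) (suc y) y∉ = ∣p∪⁅y⁆∣ p y (λ y∈ → y∉ (there y∈))

module _ {n : ℕ} where

  swap : Subset n → Fin n → Fin n → Subset n
  swap p u v = (p - u) ∪ ⁅ v ⁆

  ∈-swap⁻ : ∀ {p : Subset n} {u v x} → x ∈ swap p u v → (x ∈ p × x ≢ u) ⊎ x ≡ v
  ∈-swap⁻ {p} {u} {v} x∈ with x∈p∪q⁻ (p - u) ⁅ v ⁆ x∈
  ... | inj₁ x∈p-u = inj₁ (x∈p-y⇒x∈p p x∈p-u , x∈p-y⇒x≢y p x∈p-u)
  ... | inj₂ x∈⁅v⁆ = inj₂ (x∈⁅y⁆⇒x≡y v x∈⁅v⁆)

  ∈-swap-old : ∀ {p : Subset n} {u v x} → x ∈ p → x ≢ u → x ∈ swap p u v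
  ∈-swap-old x∈p x≢u = x∈p∪q⁺ (inj₁ (x∈p∧x≢y⇒x∈p-y x∈p x≢u))

  ∈-swap-new : ∀ {p : Subset n} {u v} → v ∈ swap p u v
  ∈-swap-new {v = v} = x∈p∪q⁺ (inj₂ (x∈⁅x⁆ v))

  ∉-swap : ∀ {p : Subset n} {u v x} → x ∈ p → x ∉ swap p u v → x ≡ u
  ∉-swap {u = u} {x = x} x∈p x∉ with x ≟ u
  ... | yes x≡u = x≡u
  ... | no x≢u = ⊥-elim (x∉ (∈-swap-old x∈p x≢u))

  ∣swap∣ : ∀ {p : Subset n} {u v} → u ∈ p → v ∉ p → ∣ swap p u v ∣ ≡ ∣ p ∣
  ∣swap∣ {p} {u} {v} u∈p v∉p =
    trans (∣p∪⁅y⁆∣ (p - u) v (λ v∈ → v∉p (x∈p-y⇒x∈p p v∈))) (∣p-x∣ p u u∈p)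

  swap-undo : ∀ {p : Subset n} {u v} → u ∈ p → v ∉ p → swap (swap p u v) v u ≡ p
  swap-undo {p} {u} {v} u∈p v∉p = ⊆-antisym undo⊆ ⊆undo
    where
    undo⊆ : swap (swap p u v) v u ⊆ p
    undo⊆ x∈ with ∈-swap⁻ x∈
    ... | inj₂ refl = u∈p
    ... | inj₁ (x∈′ , x≢v) with ∈-swap⁻ {p = p} x∈′
    ...   | inj₁ (x∈p , _) = x∈p
    ...   | inj₂ x≡v = ⊥-elim (x≢v x≡v)
    ⊆undo : p ⊆ swap (swap p u v) v u
    ⊆undo {x} x∈p with x ≟ u
    ... | yes refl = ∈-swap-new
    ... | no x≢u = ∈-swap-old (∈-swap-old x∈p x≢u) (λ { refl → v∉p x∈p })

  swap-comm : ∀ {p : Subset n} {u v x y} → v ≢ x → y ≢ u →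
              swap (swap p u v) x y ≡ swap (swap p x y) u v
  swap-comm v≢x y≢u = ⊆-antisym (comm⊆ v≢x y≢u) (comm⊆ y≢u v≢x)
    where
    comm⊆ : ∀ {p : Subset n} {u v x y} → v ≢ x → y ≢ u →
            swap (swap p u v) x y ⊆ swap (swap p x y) u v
    comm⊆ {p} v≢x y≢u z∈ with ∈-swap⁻ z∈
    ... | inj₂ refl = ∈-swap-old ∈-swap-new y≢u
    ... | inj₁ (z∈′ , z≢x) with ∈-swap⁻ {p = p} z∈′
    ...   | inj₂ refl = ∈-swap-new
    ...   | inj₁ (z∈p , z≢u) = ∈-swap-old (∈-swap-old z∈p z≢x) z≢u

  -- A swap loses only one element, so q is no swap of p if it misses
  -- two distinct elements of p.
  not-a-swap : ∀ {p q : Subset n} {x y} → x ≢ y → x ∈ p → y ∈ p → x ∉ q → y ∉ q →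
               ∀ u v → q ≢ swap p u v
  not-a-swap {p} x≢y x∈p y∈p x∉q y∉q u v refl =
    x≢y (trans (∉-swap {p = p} x∈p x∉q) (sym (∉-swap {p = p} y∈p y∉q)))

module Neighbourhoods {n : ℕ} (G : Graph n) where

  Adj-sym : ∀ {u v} → Adj G u v → Adj G v u
  Adj-sym {u} {v} uv = trans (Graph.sym G v u) uv

  Adj-irrefl : ∀ {v} → ¬ Adj G v v
  Adj-irrefl {v} vv with trans (sym vv) (Graph.irrefl G v)
  ... | ()

  N-sym : ∀ {w v} → InClosedNbhd G w v → InClosedNbhd G v w
  N-sym (inj₁ w≡v) = inj₁ (sym w≡v)
  N-sym (inj₂ vw) = inj₂ (Adj-sym vw)

  epn-adjacent : ∀ {D v w} → v ∈ D → InEPN G w v D → Adj G v w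
  epn-adjacent v∈D ((inj₁ refl , _) , w∉D) = ⊥-elim (w∉D v∈D)
  epn-adjacent v∈D ((inj₂ vw , _) , _) = vw

  pn-external : ∀ {D v w b} → b ∈ D → b ≢ v → Adj G b v →
                InPN G w v D → InEPN G w v D
  pn-external {D} {v} {w} {b} b∈D b≢v bv pn@(_ , undominated) = pn , w∉D
    where
    w∉D : w ∉ D
    w∉D w∈D with w ≟ v
    ... | yes refl = undominated b b∈D b≢v (inj₂ bv)
    ... | no w≢v = undominated w w∈D w≢v (inj₁ refl)

  pn-sole-dominator : ∀ {D v w x} → InPN G w v D → x ∈ D → InClosedNbhd G x w → x ≡ v
  pn-sole-dominator {v = v} {x = x} (_ , undominated) x∈D x∈N[w] with x ≟ v
  ... | yes x≡v = x≡v
  ... | no x≢v = ⊥-elim (undominated x x∈D x≢v (N-sym x∈N[w]))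

  edges-at⇒independent-minus :
    ∀ {D u} → (∀ c d → c ∈ D → d ∈ D → Adj G c d → c ≡ u ⊎ d ≡ u) →
    Independent G (D - u)
  edges-at⇒independent-minus {D} touch c d c∈ d∈ cd
    with touch c d (x∈p-y⇒x∈p D c∈) (x∈p-y⇒x∈p D d∈) cd
  ... | inj₁ c≡u = x∈p-y⇒x≢y D c∈ c≡u
  ... | inj₂ d≡u = x∈p-y⇒x≢y D d∈ d≡u

  independent⇒irredundant : ∀ {D} → Independent G D → Irredundant G D
  independent⇒irredundant {D} ind v v∈D = v , inj₁ refl , undominated
    where
    undominated : ∀ u → u ∈ D → u ≢ v → ¬ InClosedNbhd G v u
    undominated u u∈D u≢v (inj₁ v≡u) = u≢v (sym v≡u)
    undominated u u∈D u≢v (inj₂ uv) = ind u v u∈D v∈D uv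

  swap-independent : ∀ {D u v} → Independent G (D - u) → InEPN G v u D →
                     Independent G (swap D u v)
  swap-independent {D} {u} {v} ind ((_ , undominated) , _) c d c∈ d∈ cd
    with ∈-swap⁻ {p = D} c∈ | ∈-swap⁻ {p = D} d∈
  ... | inj₁ (c∈D , c≢u) | inj₁ (d∈D , d≢u) =
    ind c d (x∈p∧x≢y⇒x∈p-y c∈D c≢u) (x∈p∧x≢y⇒x∈p-y d∈D d≢u) cd
  ... | inj₁ (c∈D , c≢u) | inj₂ refl = undominated c c∈D c≢u (inj₂ cd)
  ... | inj₂ refl | inj₁ (d∈D , d≢u) = undominated d d∈D d≢u (inj₂ (Adj-sym cd))
  ... | inj₂ refl | inj₂ refl = Adj-irrefl cd

  swap-IRSet : ∀ {D u v} → IRSet G D → u ∈ D → v ∉ D →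
               Irredundant G (swap D u v) → IRSet G (swap D u v)
  swap-IRSet {D} (_ , maximal) u∈D v∉D irr =
    irr , λ D′ irrD′ → ≤-trans (maximal D′ irrD′) (≤-reflexive (sym (∣swap∣ {p = D} u∈D v∉D)))

  two-missing⇒¬IRAdj : ∀ {D D′ x y} → x ≢ y → x ∈ D → y ∈ D → x ∉ D′ → y ∉ D′ →
                       ¬ IRAdj G D D′
  two-missing⇒¬IRAdj x≢y x∈ y∈ x∉ y∉ (_ , _ , u , v , _ , _ , _ , D′≡) =
    not-a-swap x≢y x∈ y∈ x∉ y∉ u v D′≡

module Square {n : ℕ} (G : Graph n) {D : Subset n} {u₁ u₂ v₁ v₂ : Fin n}
  (irD : IRSet G D) (u₁≢u₂ : u₁ ≢ u₂) (u₁∈D : u₁ ∈ D) (u₂∈D : u₂ ∈ D)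
  (ind₁ : Independent G (D - u₁)) (ind₂ : Independent G (D - u₂))
  (epn₁ : InEPN G v₁ u₁ D) (epn₂ : InEPN G v₂ u₂ D) where

  open Neighbourhoods G

  Y Z W T : Subset n
  Y = swap D u₁ v₁
  Z = swap Y u₂ v₂
  W = swap D u₂ v₂
  T = swap Z v₁ u₁

  v₁∉D : v₁ ∉ D
  v₁∉D = proj₂ epn₁

  v₂∉D : v₂ ∉ D
  v₂∉D = proj₂ epn₂

  -- u₂ dominates v₂ but not v₁.
  v₁≢v₂ : v₁ ≢ v₂
  v₁≢v₂ refl = u₁≢u₂ (sym (pn-sole-dominator (proj₁ epn₁) u₂∈D (N-sym (proj₁ (proj₁ epn₂)))))

  ∈Z⁻ : ∀ {x} → x ∈ Z → (x ∈ D × x ≢ u₁ × x ≢ u₂) ⊎ x ≡ v₁ ⊎ x ≡ v₂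
  ∈Z⁻ x∈ with ∈-swap⁻ {p = Y} x∈
  ... | inj₂ x≡v₂ = inj₂ (inj₂ x≡v₂)
  ... | inj₁ (x∈Y , x≢u₂) with ∈-swap⁻ {p = D} x∈Y
  ...   | inj₂ x≡v₁ = inj₂ (inj₁ x≡v₁)
  ...   | inj₁ (x∈D , x≢u₁) = inj₁ (x∈D , x≢u₁ , x≢u₂)

  dominators-in-Z : ∀ {x u} → x ∈ D → u ∈ Z → InClosedNbhd G x u →
                    x ≡ u ⊎ (x ≡ u₁ × u ≡ v₁) ⊎ (x ≡ u₂ × u ≡ v₂)
  dominators-in-Z {x} {u} x∈D u∈Z x∈N[u] with ∈Z⁻ u∈Z
  ... | inj₂ (inj₁ refl) = inj₂ (inj₁ (pn-sole-dominator (proj₁ epn₁) x∈D x∈N[u] , refl))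
  ... | inj₂ (inj₂ refl) = inj₂ (inj₂ (pn-sole-dominator (proj₁ epn₂) x∈D x∈N[u] , refl))
  ... | inj₁ (u∈D , u≢u₁ , u≢u₂) with x∈N[u]
  ...   | inj₁ x≡u = inj₁ x≡u
  ...   | inj₂ ux with x ≟ u₁
  ...     | yes refl = ⊥-elim (ind₂ u u₁ (x∈p∧x≢y⇒x∈p-y u∈D u≢u₂) (x∈p∧x≢y⇒x∈p-y u₁∈D u₁≢u₂) ux)
  ...     | no x≢u₁ = ⊥-elim (ind₁ u x (x∈p∧x≢y⇒x∈p-y u∈D u≢u₁) (x∈p∧x≢y⇒x∈p-y x∈D x≢u₁) ux)

  u₁∉Z : u₁ ∉ Z
  u₁∉Z u₁∈Z with ∈Z⁻ u₁∈Z
  ... | inj₁ (_ , u₁≢u₁ , _) = u₁≢u₁ refl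
  ... | inj₂ (inj₁ refl) = v₁∉D u₁∈D
  ... | inj₂ (inj₂ refl) = v₂∉D u₁∈D

  u₂∉Z : u₂ ∉ Z
  u₂∉Z u₂∈Z with ∈Z⁻ u₂∈Z
  ... | inj₁ (_ , _ , u₂≢u₂) = u₂≢u₂ refl
  ... | inj₂ (inj₁ refl) = v₁∉D u₂∈D
  ... | inj₂ (inj₂ refl) = v₂∉D u₂∈D

  -- Z is irredundant: its members from D are their own private
  -- neighbours, and v₁, v₂ have the private neighbours u₁, u₂.
  Z-irredundant : Irredundant G Z
  Z-irredundant v v∈Z with ∈Z⁻ v∈Z
  ... | inj₁ (v∈D , v≢u₁ , v≢u₂) = v , inj₁ refl , undominated
    where
    undominated : ∀ u → u ∈ Z → u ≢ v → ¬ InClosedNbhd G v u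
    undominated u u∈Z u≢v v∈N[u] with dominators-in-Z v∈D u∈Z v∈N[u]
    ... | inj₁ v≡u = u≢v (sym v≡u)
    ... | inj₂ (inj₁ (v≡u₁ , _)) = v≢u₁ v≡u₁
    ... | inj₂ (inj₂ (v≡u₂ , _)) = v≢u₂ v≡u₂
  ... | inj₂ (inj₁ refl) = u₁ , N-sym (proj₁ (proj₁ epn₁)) , undominated
    where
    undominated : ∀ u → u ∈ Z → u ≢ v₁ → ¬ InClosedNbhd G u₁ u
    undominated u u∈Z u≢v₁ u₁∈N[u] with dominators-in-Z u₁∈D u∈Z u₁∈N[u]
    ... | inj₁ refl = u₁∉Z u∈Z
    ... | inj₂ (inj₁ (_ , u≡v₁)) = u≢v₁ u≡v₁
    ... | inj₂ (inj₂ (u₁≡u₂ , _)) = u₁≢u₂ u₁≡u₂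
  ... | inj₂ (inj₂ refl) = u₂ , N-sym (proj₁ (proj₁ epn₂)) , undominated
    where
    undominated : ∀ u → u ∈ Z → u ≢ v₂ → ¬ InClosedNbhd G u₂ u
    undominated u u∈Z u≢v₂ u₂∈N[u] with dominators-in-Z u₂∈D u∈Z u₂∈N[u]
    ... | inj₁ refl = u₂∉Z u∈Z
    ... | inj₂ (inj₁ (u₂≡u₁ , _)) = u₁≢u₂ (sym u₂≡u₁)
    ... | inj₂ (inj₂ (_ , u≡v₂)) = u≢v₂ u≡v₂

  T≡W : T ≡ W
  T≡W = begin
    swap (swap Y u₂ v₂) v₁ u₁  ≡⟨ swap-comm (λ v₂≡v₁ → v₁≢v₂ (sym v₂≡v₁)) u₁≢u₂ ⟩
    swap (swap Y v₁ u₁) u₂ v₂  ≡⟨ cong (λ p → swap p u₂ v₂) (swap-undo u₁∈D v₁∉D) ⟩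
    W                          ∎
    where open ≡-Reasoning

  D≡swap-T : D ≡ swap T v₂ u₂
  D≡swap-T = begin
    D                ≡⟨ sym (swap-undo u₂∈D v₂∉D) ⟩
    swap W v₂ u₂     ≡⟨ cong (λ p → swap p v₂ u₂) (sym T≡W) ⟩
    swap T v₂ u₂     ∎
    where open ≡-Reasoning

  irY : IRSet G Y
  irY = swap-IRSet irD u₁∈D v₁∉D (independent⇒irredundant (swap-independent ind₁ epn₁))

  irW : IRSet G W
  irW = swap-IRSet irD u₂∈D v₂∉D (independent⇒irredundant (swap-independent ind₂ epn₂))

  u₂∈Y : u₂ ∈ Y
  u₂∈Y = ∈-swap-old u₂∈D (λ u₂≡u₁ → u₁≢u₂ (sym u₂≡u₁))

  v₂∉Y : v₂ ∉ Y
  v₂∉Y v₂∈Y with ∈-swap⁻ {p = D} v₂∈Y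
  ... | inj₁ (v₂∈D , _) = v₂∉D v₂∈D
  ... | inj₂ v₂≡v₁ = v₁≢v₂ (sym v₂≡v₁)

  irZ : IRSet G Z
  irZ = swap-IRSet irY u₂∈Y v₂∉Y Z-irredundant

  irT : IRSet G T
  irT = subst (IRSet G) (sym T≡W) irW

  v₁∉T : v₁ ∉ T
  v₁∉T v₁∈T with ∈-swap⁻ {p = D} (subst (v₁ ∈_) T≡W v₁∈T)
  ... | inj₁ (v₁∈D , _) = v₁∉D v₁∈D
  ... | inj₂ v₁≡v₂ = v₁≢v₂ v₁≡v₂

  u₂∉T : u₂ ∉ T
  u₂∉T u₂∈T with ∈-swap⁻ {p = D} (subst (u₂ ∈_) T≡W u₂∈T)
  ... | inj₁ (_ , u₂≢u₂) = u₂≢u₂ refl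
  ... | inj₂ refl = v₂∉D u₂∈D

  v₁≢u₂ : v₁ ≢ u₂
  v₁≢u₂ refl = v₁∉D u₂∈D

  induced-square : OnInduced4Cycle G D
  induced-square =
    Y , Z , T ,
    (irD , irY , u₁ , v₁ , u₁∈D , ∈-swap-new , epn-adjacent u₁∈D epn₁ , refl) ,
    (irY , irZ , u₂ , v₂ , u₂∈Y , ∈-swap-new , epn-adjacent u₂∈D epn₂ , refl) ,
    (irZ , irT , v₁ , u₁ , ∈-swap-old ∈-swap-new v₁≢u₂ , ∈-swap-new ,
       Adj-sym (epn-adjacent u₁∈D epn₁) , refl) ,
    (irT , irD , v₂ , u₂ , subst (v₂ ∈_) (sym T≡W) ∈-swap-new , u₂∈D ,
       Adj-sym (epn-adjacent u₂∈D epn₂) , D≡swap-T) ,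
    (λ D≡Z → u₁∉Z (subst (u₁ ∈_) D≡Z u₁∈D)) ,
    (λ Y≡T → v₁∉T (subst (v₁ ∈_) Y≡T ∈-swap-new)) ,
    two-missing⇒¬IRAdj u₁≢u₂ u₁∈D u₂∈D u₁∉Z u₂∉Z ,
    two-missing⇒¬IRAdj v₁≢u₂ ∈-swap-new u₂∈Y v₁∉T u₂∉T

-- In case (i) the two ends a, b of the edge of G[X] form a square
-- configuration: every edge of G[X] touches each of them, and being
-- adjacent, their private neighbours are external.  In case (ii) the
-- two given vertices do, as X - a and X - b stay independent.
corollary4p3 : (n : ℕ) (G : Graph n) → IRGraphConnected G →
    (X : Subset n) → IRSet G X →
    (ExactlyOneEdge G X ⊎ (Independent G X × TwoWithEPN G X)) →
    OnInduced4Cycle G X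
corollary4p3 n G _ X irX (inj₁ (a , b , a∈X , b∈X , ab , only-ab)) =
  Square.induced-square G irX a≢b a∈X b∈X
    (edges-at⇒independent-minus touches-a) (edges-at⇒independent-minus touches-b)
    (pn-external b∈X (λ b≡a → a≢b (sym b≡a)) (Adj-sym ab) (proj₂ (proj₁ irX a a∈X)))
    (pn-external a∈X a≢b ab (proj₂ (proj₁ irX b b∈X)))
  where
  open Neighbourhoods G
  a≢b : a ≢ b
  a≢b refl = Adj-irrefl ab
  touches-a : ∀ c d → c ∈ X → d ∈ X → Adj G c d → c ≡ a ⊎ d ≡ a
  touches-a c d c∈ d∈ cd = Sum.map proj₁ proj₂ (only-ab c d c∈ d∈ cd)
  touches-b : ∀ c d → c ∈ X → d ∈ X → Adj G c d → c ≡ b ⊎ d ≡ b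
  touches-b c d c∈ d∈ cd = [ inj₂ ∘ proj₂ , inj₁ ∘ proj₁ ] (only-ab c d c∈ d∈ cd)
corollary4p3 n G _ X irX (inj₂ (indX , a , b , a≢b , a∈X , b∈X , (_ , epnA) , (_ , epnB))) =
  Square.induced-square G irX a≢b a∈X b∈X (independent-minus a) (independent-minus b) epnA epnB
  where
  open Neighbourhoods G
  independent-minus : ∀ u → Independent G (X - u)
  independent-minus u = edges-at⇒independent-minus λ c d c∈ d∈ cd → ⊥-elim (indX c d c∈ d∈ cd)
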